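{- Let $\mathfrak{A}$ be the set of projective points $[p,r,q]$ where $(p,r,q)$ ranges over triples of positive integers with $p^2+3r^2=q^2$ and $0<p/q\le\frac12$ (equivalently, $p=m^2-3n^2$, $r=2mn$, $q=m^2+3n^2$ with $m,n$ coprime positive integers and $\sqrt3<m/n\le3$). Let $\mathfrak{E}$ be the set of all associated pairs $\{a,b,c\}=\{[a,b,c],[b-a,b,c]\}$ of projective points, where $(a,b,c)$ ranges over primitive Eisenstein triples. Then the map $\{a,b,c\}\mapsto[|b-2a|,b,2c]$ is a well-defined bijection from $\mathfrak{E}$ onto $\mathfrak{A}$ (with inverse induced by $(p,r,q)\mapsto(\frac{r-p}{2},r,\frac q2)$).
   Context: An Eisenstein triple is $(a,b,c)\in\mathbb{Z}^3_{\ge0}\setminus\{(0,0,0)\}$ with $a^2-ab+b^2=c^2$; it is primitive if $a\le b$ and $\gcd(a,b,c)=1$. For a primitive Eisenstein triple $(a,b,c)$, $(b-a,b,c)$ is also one, and the two form an associated pair. $[x,y,z]$ denotes the projective point of a nonzero vector $(x,y,z)\in\mathbb{R}^3$. -}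

module Defs where

open import Data.Nat using (ℕ; _+_; _*_; _∸_; _≤_; _<_; ∣_-_∣)
open import Data.Nat.GCD using (gcd)
open import Data.Integer as ℤ using (ℤ; +_)
open import Data.Product using (_×_; _,_; Σ; ∃; ∃-syntax)
open import Data.Sum using (_⊎_)
open import Relation.Binary.PropositionalEquality using (_≡_)
open import Relation.Nullary using (¬_)

Triple : Set
Triple = ℕ × ℕ × ℕ

-- Projective equality [x,y,z] = [x',y',z'] of (nonzero) integer vectors:
-- the vectors are proportional, i.e. k·v = l·v' for some positive integers k, l.
_≈P_ : Triple → Triple → Set
(x , y , z) ≈P (x' , y' , z') =
  ∃[ k ] ∃[ l ] (0 < k × 0 < l × k * x ≡ l * x' × k * y ≡ l * y' × k * z ≡ l * z')

EisensteinTriple : Triple → Set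
EisensteinTriple (a , b , c) =
  ¬ (a ≡ 0 × b ≡ 0 × c ≡ 0) ×
  (+ a ℤ.* + a ℤ.- + a ℤ.* + b ℤ.+ + b ℤ.* + b ≡ + c ℤ.* + c)

PrimitiveEisenstein : Triple → Set
PrimitiveEisenstein (a , b , c) =
  EisensteinTriple (a , b , c) × a ≤ b × gcd (gcd a b) c ≡ 1

associate : Triple → Triple
associate (a , b , c) = (b ∸ a , b , c)

-- Equality of associated pairs {[a,b,c],[b-a,b,c]} as (unordered) sets of projective points.
PairEq : Triple → Triple → Set
PairEq t t' =
  (t ≈P t' × associate t ≈P associate t') ⊎
  (t ≈P associate t' × associate t ≈P t')

InA : Triple → Set
InA (p , r , q) =
  0 < p × 0 < r × 0 < q × p * p + 3 * (r * r) ≡ q * q × 2 * p ≤ q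

InAProj : Triple → Set
InAProj x = ∃[ y ] (InA y × x ≈P y)

φ : Triple → Triple
φ (a , b , c) = (∣ b - 2 * a ∣ , b , 2 * c)

-- The inverse map (p,r,q) ↦ ((r-p)/2, r, q/2), scaled by 2 (same projective point).
ψ : Triple → Triple
ψ (p , r , q) = (r ∸ p , 2 * r , q)

{-# OPTIONS --safe #-}
-- Write a triple with a ≤ b as (a, a + e, c), so that e = b − a. The Eisenstein equation becomes
-- a² + ae + e² = c², and φ sends the triple to (|a − e|, a + e, 2c), which depends only on the sum
-- and the distance of a and e, i.e. on the unordered pair {a, b − a}: this is why φ is well
-- defined and injective on associated pairs. The identity (a − e)² + 3(a + e)² = 4(a² + ae + e²)
-- puts the image on p² + 3r² = q², (a − e)² ≤ a² + e² ≤ c² gives 2p ≤ q, and p ≠ 0 because a = e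
-- would give c² = 3a², making 3 a common divisor of a, b = 2a and c. Conversely ψ(p, r, q) =
-- (r − p, 2r, q) is an Eisenstein triple with φ(ψ(x)) = 2x, and dividing it by the gcd of its
-- entries gives a primitive preimage.
module Submission where

open import Defs
open import Data.Integer as ℤ using (ℤ; +_)
import Data.Integer.Properties as ℤ
import Data.Integer.Tactic.RingSolver as ℤ-Solver
open import Data.List using (_∷_; [])
open import Data.Nat using (ℕ; zero; suc; _+_; _*_; _∸_; _≤_; _<_; ∣_-_∣; z<s; NonZero; ≢-nonZero)
open import Data.Nat.Divisibility using (_∣_; divides; ∣-trans; ∣1⇒≡1; ∣m∣n⇒∣m+n; quotient; m∣n⇒n≡m*quotient)
open import Data.Nat.GCD using (gcd; gcd[m,n]∣m; gcd[m,n]∣n; gcd-greatest; c*gcd[m,n]≡gcd[cm,cn]; gcd[m,n]≡0⇒m≡0; gcd[m,n]≡0⇒n≡0)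
open import Data.Nat.Primality using (prime?; euclidsLemma)
open import Data.Nat.Properties
open import Data.Nat.Tactic.RingSolver using (solve; solve-∀)
open import Data.Product using (_×_; _,_; ∃-syntax; proj₁; proj₂; swap)
open import Data.Sum as Sum using (_⊎_; inj₁; inj₂)
open import Function using (_∘_)
open import Relation.Binary.PropositionalEquality
open import Relation.Nullary using (¬_; contradiction)
open import Relation.Nullary.Decidable using (from-yes)
open import Algebra.Properties.CommutativeSemigroup *-commutativeSemigroup using (x∙yz≈y∙xz)

open ≡-Reasoning

≈P-refl : ∀ t → t ≈P t
≈P-refl (x , y , z) = 1 , 1 , z<s , z<s , refl , refl , refl

≈P-sym : ∀ {t t'} → t ≈P t' → t' ≈P t
≈P-sym {_ , _ , _} {_ , _ , _} (k , l , k>0 , l>0 , x , y , z) = l , k , l>0 , k>0 , sym x , sym y , sym z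

≈P-trans : ∀ {t t' t''} → t ≈P t' → t' ≈P t'' → t ≈P t''
≈P-trans {_ , _ , _} {_ , _ , _} {_ , _ , _}
  (k , l , k>0 , l>0 , x , y , z) (k' , l' , k'>0 , l'>0 , x' , y' , z') =
  k' * k , l * l' , *-mono-≤ k'>0 k>0 , *-mono-≤ l>0 l'>0 , compose x x' , compose y y' , compose z z'
  where
  compose : ∀ {u u' u''} → k * u ≡ l * u' → k' * u' ≡ l' * u'' → (k' * k) * u ≡ (l * l') * u''
  compose {u} {u'} {u''} ku ku' = begin
    (k' * k) * u   ≡⟨ *-assoc k' k u ⟩
    k' * (k * u)   ≡⟨ cong (k' *_) ku ⟩
    k' * (l * u')  ≡⟨ x∙yz≈y∙xz k' l u' ⟩
    l * (k' * u')  ≡⟨ cong (l *_) ku' ⟩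
    l * (l' * u'') ≡⟨ *-assoc l l' u'' ⟨
    (l * l') * u'' ∎

scale-double : ∀ k l {x x'} → k * x ≡ l * x' → k * (2 * x) ≡ l * (2 * x')
scale-double k l {x} {x'} kx = trans (x∙yz≈y∙xz k 2 x) (trans (cong (2 *_) kx) (sym (x∙yz≈y∙xz l 2 x')))

scale-halve : ∀ k l {x x'} → k * (2 * x) ≡ l * (2 * x') → k * x ≡ l * x'
scale-halve k l {x} {x'} k2x =
  *-cancelˡ-≡ _ _ 2 (trans (sym (x∙yz≈y∙xz k 2 x)) (trans k2x (x∙yz≈y∙xz l 2 x')))

∣m+n-2m∣≡∣m-n∣ : ∀ m n → ∣ m + n - 2 * m ∣ ≡ ∣ m - n ∣
∣m+n-2m∣≡∣m-n∣ m n = begin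
  ∣ m + n - m + (m + 0) ∣ ≡⟨ ∣m+n-m+o∣≡∣n-o∣ m n (m + 0) ⟩
  ∣ n - m + 0 ∣           ≡⟨ cong ∣ n -_∣ (+-identityʳ m) ⟩
  ∣ n - m ∣               ≡⟨ ∣-∣-comm n m ⟩
  ∣ m - n ∣               ∎

∣m-[m∸n]∣≡n : ∀ {m n} → n ≤ m → ∣ m - (m ∸ n) ∣ ≡ n
∣m-[m∸n]∣≡n {m} {n} n≤m =
  trans (∣-∣-comm m (m ∸ n)) (trans (m≤n⇒∣m-n∣≡n∸m (m∸n≤m m n)) (m∸[m∸n]≡n n≤m))

∣m-n∣*∣m-n∣+2*m*n≡m*m+n*n : ∀ m n → ∣ m - n ∣ * ∣ m - n ∣ + 2 * (m * n) ≡ m * m + n * n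
∣m-n∣*∣m-n∣+2*m*n≡m*m+n*n m n with ≤-total m n
... | inj₁ m≤n with m≤n⇒∃[o]m+o≡n m≤n
...   | d , refl rewrite ∣m-m+n∣≡n m d = solve (m ∷ d ∷ [])
∣m-n∣*∣m-n∣+2*m*n≡m*m+n*n m n | inj₂ n≤m with m≤n⇒∃[o]m+o≡n n≤m
...   | d , refl rewrite ∣-∣-comm (n + d) n | ∣m-m+n∣≡n n d = solve (n ∷ d ∷ [])

m*m≤n*n⇒m≤n : ∀ {m n} → m * m ≤ n * n → m ≤ n
m*m≤n*n⇒m≤n m*m≤n*n = ≮⇒≥ λ n<m → <⇒≱ (*-mono-< n<m n<m) m*m≤n*n

m+m≡n+n⇒m≡n : ∀ {m n} → m + m ≡ n + n → m ≡ n
m+m≡n+n⇒m≡n {zero}  {zero}  _  = refl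
m+m≡n+n⇒m≡n {zero}  {suc n} ()
m+m≡n+n⇒m≡n {suc m} {zero}  ()
m+m≡n+n⇒m≡n {suc m} {suc n} eq =
  cong suc (m+m≡n+n⇒m≡n (suc-injective (trans (sym (+-suc m m)) (trans (suc-injective eq) (+-suc n n)))))

offset-determined-by-sum-and-distance : ∀ m d m' d' →
  m + (m + d) ≡ m' + (m' + d') → ∣ m - m + d ∣ ≡ ∣ m' - m' + d' ∣ → m ≡ m' × m + d ≡ m' + d'
offset-determined-by-sum-and-distance m d m' d' sum distance = m≡m' , cong₂ _+_ m≡m' d≡d'
  where
  d≡d' : d ≡ d'
  d≡d' = trans (sym (∣m-m+n∣≡n m d)) (trans distance (∣m-m+n∣≡n m' d'))
  m≡m' : m ≡ m'
  m≡m' = m+m≡n+n⇒m≡n (+-cancelʳ-≡ d (m + m) (m' + m') (begin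
    m + m + d       ≡⟨ +-assoc m m d ⟩
    m + (m + d)     ≡⟨ sum ⟩
    m' + (m' + d')  ≡⟨ cong (λ x → m' + (m' + x)) d≡d' ⟨
    m' + (m' + d)   ≡⟨ +-assoc m' m' d ⟨
    m' + m' + d     ∎))

≤-pair-determined-by-sum-and-distance : ∀ {x y x' y'} → x ≤ y → x' ≤ y' →
  x + y ≡ x' + y' → ∣ x - y ∣ ≡ ∣ x' - y' ∣ → x ≡ x' × y ≡ y'
≤-pair-determined-by-sum-and-distance {x} {_} {x'} x≤y x'≤y'
  with m≤n⇒∃[o]m+o≡n x≤y | m≤n⇒∃[o]m+o≡n x'≤y'
... | d , refl | d' , refl = offset-determined-by-sum-and-distance x d x' d'

pair-determined-by-sum-and-distance : ∀ {x y x' y'} → x + y ≡ x' + y' → ∣ x - y ∣ ≡ ∣ x' - y' ∣ →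
  (x ≡ x' × y ≡ y') ⊎ (x ≡ y' × y ≡ x')
pair-determined-by-sum-and-distance {x} {y} {x'} {y'} sum distance with ≤-total x y | ≤-total x' y'
... | inj₁ x≤y | inj₁ x'≤y' = inj₁ (≤-pair-determined-by-sum-and-distance x≤y x'≤y' sum distance)
... | inj₁ x≤y | inj₂ y'≤x' = inj₂ (≤-pair-determined-by-sum-and-distance x≤y y'≤x'
  (trans sum (+-comm x' y')) (trans distance (∣-∣-comm x' y')))
... | inj₂ y≤x | inj₁ x'≤y' = inj₂ (swap (≤-pair-determined-by-sum-and-distance y≤x x'≤y'
  (trans (+-comm y x) sum) (trans (∣-∣-comm y x) distance)))
... | inj₂ y≤x | inj₂ y'≤x' = inj₁ (swap (≤-pair-determined-by-sum-and-distance y≤x y'≤x'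
  (trans (+-comm y x) (trans sum (+-comm x' y'))) (trans (∣-∣-comm y x) (trans distance (∣-∣-comm x' y')))))

löschian : ℕ → ℕ → ℕ
löschian a e = a * a + a * e + e * e

eisensteinForm : ℤ → ℤ → ℤ
eisensteinForm a b = a ℤ.* a ℤ.- a ℤ.* b ℤ.+ b ℤ.* b

eisensteinForm-offset : ∀ a e → eisensteinForm (+ a) (+ (a + e)) ≡ + löschian a e
eisensteinForm-offset a e = begin
  eisensteinForm (+ a) (+ (a + e))                ≡⟨ cong (eisensteinForm (+ a)) (ℤ.pos-+ a e) ⟩
  eisensteinForm (+ a) (+ a ℤ.+ + e)              ≡⟨ expand (+ a) (+ e) ⟩
  + a ℤ.* + a ℤ.+ + a ℤ.* + e ℤ.+ + e ℤ.* + e     ≡⟨ cong₂ ℤ._+_ (cong₂ ℤ._+_ (ℤ.pos-* a a) (ℤ.pos-* a e)) (ℤ.pos-* e e) ⟨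
  + (a * a) ℤ.+ + (a * e) ℤ.+ + (e * e)           ≡⟨ cong (ℤ._+ + (e * e)) (ℤ.pos-+ (a * a) (a * e)) ⟨
  + (a * a + a * e) ℤ.+ + (e * e)                 ≡⟨ ℤ.pos-+ (a * a + a * e) (e * e) ⟨
  + löschian a e                                  ∎
  where
  expand : ∀ x y → x ℤ.* x ℤ.- x ℤ.* (x ℤ.+ y) ℤ.+ (x ℤ.+ y) ℤ.* (x ℤ.+ y)
                   ≡ x ℤ.* x ℤ.+ x ℤ.* y ℤ.+ y ℤ.* y
  expand = ℤ-Solver.solve-∀

eisenstein⇒löschian : ∀ a e c → eisensteinForm (+ a) (+ (a + e)) ≡ + c ℤ.* + c → löschian a e ≡ c * c
eisenstein⇒löschian a e c eq = ℤ.+-injective (trans (sym (eisensteinForm-offset a e)) (trans eq (sym (ℤ.pos-* c c))))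

eisensteinForm-homogeneous : ∀ k x y → eisensteinForm (k ℤ.* x) (k ℤ.* y) ≡ k ℤ.* (k ℤ.* eisensteinForm x y)
eisensteinForm-homogeneous = expanded
  where
  expanded : ∀ k x y → (k ℤ.* x) ℤ.* (k ℤ.* x) ℤ.- (k ℤ.* x) ℤ.* (k ℤ.* y) ℤ.+ (k ℤ.* y) ℤ.* (k ℤ.* y)
                       ≡ k ℤ.* (k ℤ.* (x ℤ.* x ℤ.- x ℤ.* y ℤ.+ y ℤ.* y))
  expanded = ℤ-Solver.solve-∀

eisenstein-cancel : ∀ g a b c .{{_ : NonZero g}} →
  eisensteinForm (+ (g * a)) (+ (g * b)) ≡ + (g * c) ℤ.* + (g * c) → eisensteinForm (+ a) (+ b) ≡ + c ℤ.* + c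
eisenstein-cancel g a b c eq = ℤ.*-cancelˡ-≡ (+ g) _ _ (ℤ.*-cancelˡ-≡ (+ g) _ _ (begin
  + g ℤ.* (+ g ℤ.* eisensteinForm (+ a) (+ b)) ≡⟨ eisensteinForm-homogeneous (+ g) (+ a) (+ b) ⟨
  eisensteinForm (+ g ℤ.* + a) (+ g ℤ.* + b)   ≡⟨ cong₂ eisensteinForm (ℤ.pos-* g a) (ℤ.pos-* g b) ⟨
  eisensteinForm (+ (g * a)) (+ (g * b))       ≡⟨ eq ⟩
  + (g * c) ℤ.* + (g * c)                      ≡⟨ cong₂ ℤ._*_ (ℤ.pos-* g c) (ℤ.pos-* g c) ⟩
  (+ g ℤ.* + c) ℤ.* (+ g ℤ.* + c)              ≡⟨ square-homogeneous (+ g) (+ c) ⟩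
  + g ℤ.* (+ g ℤ.* (+ c ℤ.* + c))              ∎))
  where
  square-homogeneous : ∀ k z → (k ℤ.* z) ℤ.* (k ℤ.* z) ≡ k ℤ.* (k ℤ.* (z ℤ.* z))
  square-homogeneous = ℤ-Solver.solve-∀

Ordered : Triple → Set
Ordered (a , b , _) = a ≤ b

φ-offset : ∀ a e c → φ (a , a + e , c) ≡ (∣ a - e ∣ , a + e , 2 * c)
φ-offset a e c = cong (λ p → p , a + e , 2 * c) (∣m+n-2m∣≡∣m-n∣ a e)

associate-offset : ∀ a e c → associate (a , a + e , c) ≡ (e , a + e , c)
associate-offset a e c = cong (λ x → x , a + e , c) (m+n∸m≡n a e)

φ-associate-offset : ∀ a e c → φ (associate (a , a + e , c)) ≡ φ (a , a + e , c)
φ-associate-offset a e c = cong (λ p → p , a + e , 2 * c) (begin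
  ∣ a + e - 2 * (a + e ∸ a) ∣ ≡⟨ cong (λ x → ∣ a + e - 2 * x ∣) (m+n∸m≡n a e) ⟩
  ∣ a + e - 2 * e ∣           ≡⟨ cong (λ x → ∣ x - 2 * e ∣) (+-comm a e) ⟩
  ∣ e + a - 2 * e ∣           ≡⟨ ∣m+n-2m∣≡∣m-n∣ e a ⟩
  ∣ e - a ∣                   ≡⟨ ∣-∣-comm e a ⟩
  ∣ a - e ∣                   ≡⟨ ∣m+n-2m∣≡∣m-n∣ a e ⟨
  ∣ a + e - 2 * a ∣           ∎)

φ-cong : ∀ {t t'} → t ≈P t' → φ t ≈P φ t'
φ-cong {a , b , c} {a' , b' , c'} (k , l , k>0 , l>0 , ka , kb , kc) =
  k , l , k>0 , l>0 , distance , kb , scale-double k l kc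
  where
  distance : k * ∣ b - 2 * a ∣ ≡ l * ∣ b' - 2 * a' ∣
  distance = begin
    k * ∣ b - 2 * a ∣             ≡⟨ *-distribˡ-∣-∣ k b (2 * a) ⟩
    ∣ k * b - k * (2 * a) ∣       ≡⟨ cong₂ ∣_-_∣ kb (scale-double k l ka) ⟩
    ∣ l * b' - l * (2 * a') ∣     ≡⟨ *-distribˡ-∣-∣ l b' (2 * a') ⟨
    l * ∣ b' - 2 * a' ∣           ∎

φ-respects-PairEq : ∀ {t t'} → Ordered t' → PairEq t t' → φ t ≈P φ t'
φ-respects-PairEq {t} {a' , b' , c'} a'≤b' with m≤n⇒∃[o]m+o≡n a'≤b'
... | e' , refl = λ where
  (inj₁ (t≈t' , _))  → φ-cong t≈t'
  (inj₂ (t≈at' , _)) → subst (φ t ≈P_) (φ-associate-offset a' e' c') (φ-cong t≈at')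

φ-injective-offset : ∀ a e c a' e' c' →
  (∣ a - e ∣ , a + e , 2 * c) ≈P (∣ a' - e' ∣ , a' + e' , 2 * c') → PairEq (a , a + e , c) (a' , a' + e' , c')
φ-injective-offset a e c a' e' c' (k , l , k>0 , l>0 , distance , sum , doubled) =
  Sum.map same swapped (pair-determined-by-sum-and-distance sum′ distance′)
  where
  sum′ : k * a + k * e ≡ l * a' + l * e'
  sum′ = trans (sym (*-distribˡ-+ k a e)) (trans sum (*-distribˡ-+ l a' e'))
  distance′ : ∣ k * a - k * e ∣ ≡ ∣ l * a' - l * e' ∣
  distance′ = trans (sym (*-distribˡ-∣-∣ k a e)) (trans distance (*-distribˡ-∣-∣ l a' e'))
  scaled : ∀ {x x'} → k * x ≡ l * x' → (x , a + e , c) ≈P (x' , a' + e' , c')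
  scaled kx = k , l , k>0 , l>0 , kx , sum , scale-halve k l doubled
  same : k * a ≡ l * a' × k * e ≡ l * e' →
    (a , a + e , c) ≈P (a' , a' + e' , c') × associate (a , a + e , c) ≈P associate (a' , a' + e' , c')
  same (ka , ke) = scaled ka , subst₂ _≈P_ (sym (associate-offset a e c)) (sym (associate-offset a' e' c')) (scaled ke)
  swapped : k * a ≡ l * e' × k * e ≡ l * a' →
    (a , a + e , c) ≈P associate (a' , a' + e' , c') × associate (a , a + e , c) ≈P (a' , a' + e' , c')
  swapped (ka , ke) = subst ((a , a + e , c) ≈P_) (sym (associate-offset a' e' c')) (scaled ka) ,
                      subst (_≈P (a' , a' + e' , c')) (sym (associate-offset a e c)) (scaled ke)

φ-injective : ∀ {t t'} → Ordered t → Ordered t' → φ t ≈P φ t' → PairEq t t'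
φ-injective {a , _ , c} {a' , _ , c'} a≤b a'≤b' with m≤n⇒∃[o]m+o≡n a≤b | m≤n⇒∃[o]m+o≡n a'≤b'
... | e , refl | e' , refl = φ-injective-offset a e c a' e' c' ∘ subst₂ _≈P_ (φ-offset a e c) (φ-offset a' e' c')

InA⇒p≤r : ∀ {p r q} → InA (p , r , q) → p ≤ r
InA⇒p≤r {p} {r} {q} (_ , _ , _ , conic , 2p≤q) = ≮⇒≥ λ r<p → <⇒≱ (q*q<2p*2p r<p) (*-mono-≤ 2p≤q 2p≤q)
  where
  p*p+3*[p*p]≡2p*2p : p * p + 3 * (p * p) ≡ 2 * p * (2 * p)
  p*p+3*[p*p]≡2p*2p = solve (p ∷ [])
  q*q<2p*2p : r < p → q * q < 2 * p * (2 * p)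
  q*q<2p*2p r<p = subst₂ _<_ conic p*p+3*[p*p]≡2p*2p (+-monoʳ-< (p * p) (*-monoʳ-< 3 (*-mono-< r<p r<p)))

ψ-ordered : ∀ x → Ordered (ψ x)
ψ-ordered (p , r , q) = ≤-trans (m∸n≤m r p) (m≤m+n r (r + 0))

φ∘ψ≈P : ∀ {p r q} → p ≤ r → φ (ψ (p , r , q)) ≈P (p , r , q)
φ∘ψ≈P {p} {r} {q} p≤r = 1 , 2 , z<s , z<s , distance , *-identityˡ (2 * r) , *-identityˡ (2 * q)
  where
  distance : 1 * ∣ 2 * r - 2 * (r ∸ p) ∣ ≡ 2 * p
  distance = begin
    1 * ∣ 2 * r - 2 * (r ∸ p) ∣ ≡⟨ *-identityˡ _ ⟩
    ∣ 2 * r - 2 * (r ∸ p) ∣     ≡⟨ cong ∣ 2 * r -_∣ (*-distribˡ-∸ 2 r p) ⟩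
    ∣ 2 * r - (2 * r ∸ 2 * p) ∣ ≡⟨ ∣m-[m∸n]∣≡n (*-monoʳ-≤ 2 p≤r) ⟩
    2 * p                       ∎

ψ-eisenstein : ∀ {x} → InA x → EisensteinTriple (ψ x)
ψ-eisenstein {p , r , q} x∈𝔄@(_ , _ , q>0 , conic , _) with m≤n⇒∃[o]m+o≡n (InA⇒p≤r x∈𝔄)
... | s , refl = (λ (_ , _ , q≡0) → m<n⇒n≢0 q>0 q≡0) , (begin
  eisensteinForm (+ (p + s ∸ p)) (+ (2 * (p + s))) ≡⟨ cong₂ (λ a b → eisensteinForm (+ a) (+ b)) (m+n∸m≡n p s) 2[p+s] ⟩
  eisensteinForm (+ s) (+ (s + (2 * p + s)))       ≡⟨ eisensteinForm-offset s (2 * p + s) ⟩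
  + löschian s (2 * p + s)                         ≡⟨ cong +_ (trans (löschian-ψ p s) conic) ⟩
  + (q * q)                                        ≡⟨ ℤ.pos-* q q ⟩
  + q ℤ.* + q                                      ∎)
  where
  2[p+s] : 2 * (p + s) ≡ s + (2 * p + s)
  2[p+s] = solve (p ∷ s ∷ [])
  löschian-ψ : ∀ p s → s * s + s * (2 * p + s) + (2 * p + s) * (2 * p + s) ≡ p * p + 3 * ((p + s) * (p + s))
  löschian-ψ = solve-∀

primitive-multiple : ∀ {a b c} → EisensteinTriple (a , b , c) → a ≤ b →
  ∃[ t ] (PrimitiveEisenstein t × t ≈P (a , b , c))
primitive-multiple {a} {b} {c} (nonzero , eq) a≤b =
  (a' , b' , c') , ((nonzero' , eq') , a'≤b' , coprime) ,
  (g , 1 , n≢0⇒n>0 g≢0 , z<s , sym (trans (*-identityˡ a) a≡ga') ,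
   sym (trans (*-identityˡ b) b≡gb') , sym (trans (*-identityˡ c) c≡gc'))
  where
  g : ℕ
  g = gcd (gcd a b) c
  g∣a : g ∣ a
  g∣a = ∣-trans (gcd[m,n]∣m (gcd a b) c) (gcd[m,n]∣m a b)
  g∣b : g ∣ b
  g∣b = ∣-trans (gcd[m,n]∣m (gcd a b) c) (gcd[m,n]∣n a b)
  g∣c : g ∣ c
  g∣c = gcd[m,n]∣n (gcd a b) c
  a' b' c' : ℕ
  a' = quotient g∣a
  b' = quotient g∣b
  c' = quotient g∣c
  a≡ga' : a ≡ g * a'
  a≡ga' = m∣n⇒n≡m*quotient g∣a
  b≡gb' : b ≡ g * b'
  b≡gb' = m∣n⇒n≡m*quotient g∣b
  c≡gc' : c ≡ g * c'
  c≡gc' = m∣n⇒n≡m*quotient g∣c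
  g≢0 : g ≢ 0
  g≢0 g≡0 =
    nonzero (gcd[m,n]≡0⇒m≡0 gcd[a,b]≡0 , gcd[m,n]≡0⇒n≡0 a gcd[a,b]≡0 , gcd[m,n]≡0⇒n≡0 (gcd a b) g≡0)
    where
    gcd[a,b]≡0 : gcd a b ≡ 0
    gcd[a,b]≡0 = gcd[m,n]≡0⇒m≡0 g≡0
  instance
    g-nonZero : NonZero g
    g-nonZero = ≢-nonZero g≢0
  vanishes : ∀ {x x'} → x ≡ g * x' → x' ≡ 0 → x ≡ 0
  vanishes x≡gx' refl = trans x≡gx' (*-zeroʳ g)
  nonzero' : ¬ (a' ≡ 0 × b' ≡ 0 × c' ≡ 0)
  nonzero' (a'≡0 , b'≡0 , c'≡0) = nonzero (vanishes a≡ga' a'≡0 , vanishes b≡gb' b'≡0 , vanishes c≡gc' c'≡0)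
  eq' : eisensteinForm (+ a') (+ b') ≡ + c' ℤ.* + c'
  eq' = eisenstein-cancel g a' b' c' (begin
    eisensteinForm (+ (g * a')) (+ (g * b')) ≡⟨ cong₂ (λ x y → eisensteinForm (+ x) (+ y)) a≡ga' b≡gb' ⟨
    eisensteinForm (+ a) (+ b)               ≡⟨ eq ⟩
    + c ℤ.* + c                              ≡⟨ cong (λ z → + z ℤ.* + z) c≡gc' ⟩
    + (g * c') ℤ.* + (g * c')                ∎)
  a'≤b' : a' ≤ b'
  a'≤b' = *-cancelˡ-≤ g (subst₂ _≤_ a≡ga' b≡gb' a≤b)
  coprime : gcd (gcd a' b') c' ≡ 1
  coprime = *-cancelˡ-≡ _ 1 g (begin
    g * gcd (gcd a' b') c'               ≡⟨ c*gcd[m,n]≡gcd[cm,cn] g (gcd a' b') c' ⟩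
    gcd (g * gcd a' b') (g * c')         ≡⟨ cong (λ x → gcd x (g * c')) (c*gcd[m,n]≡gcd[cm,cn] g a' b') ⟩
    gcd (gcd (g * a') (g * b')) (g * c') ≡⟨ cong₂ gcd (cong₂ gcd a≡ga' b≡gb') c≡gc' ⟨
    g                                    ≡⟨ *-identityʳ g ⟨
    g * 1                                ∎)

∣a-e∣*∣a-e∣+3*[a+e]*[a+e]≡4*löschian : ∀ a e →
  ∣ a - e ∣ * ∣ a - e ∣ + 3 * ((a + e) * (a + e)) ≡ 4 * löschian a e
∣a-e∣*∣a-e∣+3*[a+e]*[a+e]≡4*löschian a e = begin
  D * D + 3 * ((a + e) * (a + e))                                   ≡⟨ regroup D a e ⟩
  (D * D + 2 * (a * e)) + (3 * (a * a) + 4 * (a * e) + 3 * (e * e)) ≡⟨ cong₂ _+_ (∣m-n∣*∣m-n∣+2*m*n≡m*m+n*n a e) refl ⟩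
  (a * a + e * e) + (3 * (a * a) + 4 * (a * e) + 3 * (e * e))       ≡⟨ collect a e ⟩
  4 * löschian a e                                                  ∎
  where
  D : ℕ
  D = ∣ a - e ∣
  regroup : ∀ D a e → D * D + 3 * ((a + e) * (a + e)) ≡
                      (D * D + 2 * (a * e)) + (3 * (a * a) + 4 * (a * e) + 3 * (e * e))
  regroup = solve-∀
  collect : ∀ a e → (a * a + e * e) + (3 * (a * a) + 4 * (a * e) + 3 * (e * e)) ≡
                    4 * (a * a + a * e + e * e)
  collect = solve-∀

löschian≡c*c⇒∣a-e∣≤c : ∀ a e c → löschian a e ≡ c * c → ∣ a - e ∣ ≤ c
löschian≡c*c⇒∣a-e∣≤c a e c löschian≡c*c = m*m≤n*n⇒m≤n (≤-trans (m≤m+n (∣ a - e ∣ * ∣ a - e ∣) (2 * (a * e)))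
  (subst₂ _≤_ (sym (∣m-n∣*∣m-n∣+2*m*n≡m*m+n*n a e)) löschian≡c*c a*a+e*e≤löschian))
  where
  a*a+e*e≤löschian : a * a + e * e ≤ löschian a e
  a*a+e*e≤löschian = +-monoˡ-≤ (e * e) (m≤m+n (a * a) (a * e))

löschian-positive : ∀ a e c → löschian a e ≡ c * c → ¬ (a ≡ 0 × a + e ≡ 0 × c ≡ 0) →
  0 < a + e × 0 < 2 * c
löschian-positive zero    zero    zero    _  nonzero = contradiction (refl , refl , refl) nonzero
löschian-positive zero    (suc e) (suc c) _  _       = z<s , z<s
löschian-positive (suc a) e       (suc c) _  _       = z<s , z<s
löschian-positive zero    zero    (suc c) () _
löschian-positive zero    (suc e) zero    () _
löschian-positive (suc a) e       zero    () _

c*c≡3*[a*a]⇒3∣a∧3∣c : ∀ {a c} → c * c ≡ 3 * (a * a) → 3 ∣ a × 3 ∣ c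
c*c≡3*[a*a]⇒3∣a∧3∣c {a} {c} c*c≡3*[a*a] =
  3∣square (divides (q * q) (trans a*a≡3*[q*q] (*-comm 3 (q * q)))) , 3∣c
  where
  3∣square : ∀ {m} → 3 ∣ m * m → 3 ∣ m
  3∣square {m} = Sum.reduce ∘ euclidsLemma m m (from-yes (prime? 3))
  3∣c : 3 ∣ c
  3∣c = 3∣square (divides (a * a) (trans c*c≡3*[a*a] (*-comm 3 (a * a))))
  q : ℕ
  q = quotient 3∣c
  [3*q]*[3*q]≡3*[3*[q*q]] : ∀ q → (3 * q) * (3 * q) ≡ 3 * (3 * (q * q))
  [3*q]*[3*q]≡3*[3*[q*q]] = solve-∀
  a*a≡3*[q*q] : a * a ≡ 3 * (q * q)
  a*a≡3*[q*q] = *-cancelˡ-≡ _ _ 3 (begin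
    3 * (a * a)        ≡⟨ c*c≡3*[a*a] ⟨
    c * c              ≡⟨ cong (λ x → x * x) (m∣n⇒n≡m*quotient 3∣c) ⟩
    (3 * q) * (3 * q)  ≡⟨ [3*q]*[3*q]≡3*[3*[q*q]] q ⟩
    3 * (3 * (q * q))  ∎)

löschian≡c*c⇒coprime⇒a≢e : ∀ a e c → löschian a e ≡ c * c → gcd (gcd a (a + e)) c ≡ 1 → a ≢ e
löschian≡c*c⇒coprime⇒a≢e a e c löschian≡c*c coprime refl =
  contradiction (∣1⇒≡1 (subst (3 ∣_) coprime 3∣gcd)) λ ()
  where
  löschian-diagonal : ∀ a → a * a + a * a + a * a ≡ 3 * (a * a)
  löschian-diagonal = solve-∀
  3∣a×3∣c : 3 ∣ a × 3 ∣ c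
  3∣a×3∣c = c*c≡3*[a*a]⇒3∣a∧3∣c (trans (sym löschian≡c*c) (löschian-diagonal a))
  3∣a : 3 ∣ a
  3∣a = proj₁ 3∣a×3∣c
  3∣gcd : 3 ∣ gcd (gcd a (a + a)) c
  3∣gcd = gcd-greatest (gcd-greatest 3∣a (∣m∣n⇒∣m+n 3∣a 3∣a)) (proj₂ 3∣a×3∣c)

φ-in-𝔄 : ∀ {t} → PrimitiveEisenstein t → InA (φ t)
φ-in-𝔄 {a , b , c} ((nonzero , eq) , a≤b , coprime) with m≤n⇒∃[o]m+o≡n a≤b
... | e , refl = subst InA (sym (φ-offset a e c))
  (n≢0⇒n>0 (a≢e ∘ ∣m-n∣≡0⇒m≡n) , proj₁ positive , proj₂ positive , conic , 2∣a-e∣≤2c)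
  where
  löschian≡c*c : löschian a e ≡ c * c
  löschian≡c*c = eisenstein⇒löschian a e c eq
  a≢e : a ≢ e
  a≢e = löschian≡c*c⇒coprime⇒a≢e a e c löschian≡c*c coprime
  positive : 0 < a + e × 0 < 2 * c
  positive = löschian-positive a e c löschian≡c*c nonzero
  4*[c*c]≡2c*2c : ∀ c → 4 * (c * c) ≡ 2 * c * (2 * c)
  4*[c*c]≡2c*2c = solve-∀
  conic : ∣ a - e ∣ * ∣ a - e ∣ + 3 * ((a + e) * (a + e)) ≡ 2 * c * (2 * c)
  conic = trans (∣a-e∣*∣a-e∣+3*[a+e]*[a+e]≡4*löschian a e)
                (trans (cong (4 *_) löschian≡c*c) (4*[c*c]≡2c*2c c))
  2∣a-e∣≤2c : 2 * ∣ a - e ∣ ≤ 2 * c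
  2∣a-e∣≤2c = *-monoʳ-≤ 2 (löschian≡c*c⇒∣a-e∣≤c a e c löschian≡c*c)

φ-surjective : ∀ {x y} → InA y → x ≈P y → ∃[ t ] (PrimitiveEisenstein t × φ t ≈P x)
φ-surjective {x} {y@(p , r , q)} y∈𝔄 x≈y = preimage (primitive-multiple (ψ-eisenstein {y} y∈𝔄) (ψ-ordered y))
  where
  preimage : ∃[ t ] (PrimitiveEisenstein t × t ≈P ψ y) → ∃[ t ] (PrimitiveEisenstein t × φ t ≈P x)
  preimage (t , t-primitive , t≈ψy) =
    t , t-primitive , ≈P-trans (φ-cong t≈ψy) (≈P-trans (φ∘ψ≈P (InA⇒p≤r y∈𝔄)) (≈P-sym x≈y))

φ-inverse-ψ : ∀ {x t} → InA x → Ordered t → φ t ≈P x → t ≈P ψ x ⊎ associate t ≈P ψ x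
φ-inverse-ψ {x@(p , r , q)} {t} x∈𝔄 t-ordered φt≈x =
  Sum.map proj₁ proj₂ (φ-injective t-ordered (ψ-ordered x) φt≈φ[ψx])
  where
  φt≈φ[ψx] : φ t ≈P φ (ψ x)
  φt≈φ[ψx] = ≈P-trans φt≈x (≈P-sym (φ∘ψ≈P (InA⇒p≤r x∈𝔄)))

lemma4p5 :
    -- the image of every associated pair lies in 𝔄
    ((t : Triple) → PrimitiveEisenstein t → InAProj (φ t)) ×
    -- well-defined on associated pairs (as sets of projective points)
    ((t t' : Triple) → PrimitiveEisenstein t → PrimitiveEisenstein t' →
      PairEq t t' → φ t ≈P φ t') ×
    -- injective
    ((t t' : Triple) → PrimitiveEisenstein t → PrimitiveEisenstein t' →
      φ t ≈P φ t' → PairEq t t') ×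
    -- surjective onto 𝔄
    ((x y : Triple) → InA y → x ≈P y →
      ∃[ t ] (PrimitiveEisenstein t × φ t ≈P x)) ×
    -- the inverse is induced by (p,r,q) ↦ ((r-p)/2, r, q/2)
    ((x t : Triple) → InA x → PrimitiveEisenstein t → φ t ≈P x →
      (t ≈P ψ x ⊎ associate t ≈P ψ x))
lemma4p5 =
  (λ t t-primitive → φ t , φ-in-𝔄 t-primitive , ≈P-refl (φ t)) ,
  (λ _ _ _ (_ , t'-ordered , _) → φ-respects-PairEq t'-ordered) ,
  (λ _ _ (_ , t-ordered , _) (_ , t'-ordered , _) → φ-injective t-ordered t'-ordered) ,
  (λ _ _ → φ-surjective) ,
  (λ _ _ x∈𝔄 (_ , t-ordered , _) → φ-inverse-ψ x∈𝔄 t-ordered)
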